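{- Let $P$ be a set of path axioms. Every $\mathsf{G3Kt} + \textit{LabPr(P)}$ proof of a labeled polytree sequent consists solely of labeled polytree sequents.
   Context: Tense formulae: $A ::= p \mid \overline{p} \mid A\wedge A \mid A\vee A \mid \Box A \mid \Diamond A \mid \blacksquare A \mid \Diamond^{ - }A$, with $\Diamond^{ - }$ the past diamond. A path axiom has the form $\langle ?\rangle_1\cdots\langle ?\rangle_n A\rightarrow\langle ?\rangle A$ with $\langle ?\rangle_j,\langle ?\rangle\in\{\Diamond,\Diamond^{ - }\}$. Labeled sequents $\mathcal{R},\Gamma$ (relational atoms $Rxy$, labeled formulae $x:A$); a labeled polytree sequent is one whose graph (labels as vertices, edge $(x,y)$ for each $Rxy$) has a tree as underlying undirected graph. $\mathsf{G3Kt}$ has rules: $(\textsf{id})$ $\mathcal{R},x:p,x:\overline{p},\Gamma$; $(\vee)$,$(\wedge)$ labelwise; $(\Box)$ from $\mathcal{R},Rxy,y:A,\Gamma$ infer $\mathcal{R},x:\Box A,\Gamma$ ($y$ not in conclusion); $(\Diamond)$ from $\mathcal{R},Rxy,y:A,x:\Diamond A,\Gamma$ infer $\mathcal{R},Rxy,x:\Diamond A,\Gamma$; $(\blacksquare)$ from $\mathcal{R},Ryx,y:A,\Gamma$ infer $\mathcal{R},x:\blacksquare A,\Gamma$ ($y$ not in conclusion); $(\Diamond^{ - })$ from $\mathcal{R},Ryx,y:A,x:\Diamond^{ - }A,\Gamma$ infer $\mathcal{R},Ryx,x:\Diamond^{ - }A,\Gamma$. The propagation graph of $\mathcal{R},\Gamma$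 has edges $(x,y,\Diamond)$ and $(y,x,\Diamond^{ - })$ for each $Rxy\in\mathcal{R}$; a path's string is the sequence of its edge labels. $(P\cup I(P))^*$ denotes the closure of $P$ and the inverses of its axioms (reverse the antecedent string and swap $\Diamond\leftrightarrow\Diamond^{ - }$ throughout) under composition (substituting an axiom's antecedent for a matching diamond in another axiom's antecedent), containing also $\Diamond A\rightarrow\Diamond A$ and $\Diamond^{ - }A\rightarrow\Diamond^{ - }A$. $\textit{LabPr(P)}$ contains all rules: from $\mathcal{R}, x: \langle ?\rangle A, y:A, \Gamma$ infer $\mathcal{R}, x: \langle ?\rangle A, \Gamma$, provided some path from $x$ to $y$ in the premise's propagation graph has string $\Pi$ with $\Pi A \rightarrow \langle ?\rangle A \in (P \cup I(P))^{*}$. -}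

module Defs where

open import Data.Nat using (ℕ)
open import Data.Product using (_×_; _,_; proj₁; ∃; ∃-syntax)
open import Data.List using (List; []; _∷_; _++_; [_]; map; concatMap; reverse)
open import Data.List.Membership.Propositional using (_∈_; _∉_)
open import Data.List.Relation.Binary.Permutation.Propositional using (_↭_)
open import Data.List.Relation.Unary.Unique.Propositional using (Unique)
open import Relation.Nullary using (¬_)

-- Tense formulae (negation normal form)

data Fml : Set where
  var  : ℕ → Fml
  nvar : ℕ → Fml
  _∧_  : Fml → Fml → Fml
  _∨_  : Fml → Fml → Fml
  □    : Fml → Fml
  ◇    : Fml → Fml
  ■    : Fml → Fml          -- past box
  ◇⁻   : Fml → Fml

data Dia : Set where
  fut  : Dia
  past : Dia

⟨_⟩_ : Dia → Fml → Fml
⟨ fut ⟩ A  = ◇ A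
⟨ past ⟩ A = ◇⁻ A

swap : Dia → Dia
swap fut  = past
swap past = fut

-- Path axioms  ⟨?⟩₁ ⋯ ⟨?⟩ₙ A → ⟨?⟩ A  are represented by the pair
-- (antecedent string ⟨?⟩₁ ⋯ ⟨?⟩ₙ , consequent diamond ⟨?⟩).
-- A set of path axioms is a predicate on such pairs.

PathAxioms : Set₁
PathAxioms = List Dia → Dia → Set

-- (P ∪ I(P))* : closure of P and the inverses of its axioms under
-- composition, also containing ◇A → ◇A and ◇⁻A → ◇⁻A.
data Closure (P : PathAxioms) : List Dia → Dia → Set where
  ax   : ∀ {Π d} → P Π d → Closure P Π d
  inv  : ∀ {Π d} → P Π d → Closure P (reverse (map swap Π)) (swap d)
  refl : ∀ d → Closure P [ d ] d
  comp : ∀ {Π₁ Π₂ Σ d e} →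
         Closure P (Π₁ ++ d ∷ Π₂) e → Closure P Σ d →
         Closure P (Π₁ ++ Σ ++ Π₂) e

-- Labeled sequents  R , Γ  (labels are natural numbers;
-- Rxy is the pair (x , y); x : A is the pair (x , A)).
-- Sequents are multisets: represented by lists, rules apply up to
-- permutation.

record Seq : Set where
  constructor mkSeq
  field
    rel : List (ℕ × ℕ)
    fml : List (ℕ × Fml)
open Seq public

_≈S_ : Seq → Seq → Set
S ≈S T = (rel S ↭ rel T) × (fml S ↭ fml T)

labels : Seq → List ℕ
labels S = concatMap (λ { (x , y) → x ∷ y ∷ [] }) (rel S) ++ map proj₁ (fml S)

-- Paths in the propagation graph of R (edges (x,y,◇) and (y,x,◇⁻) for
-- each Rxy ∈ R), together with their strings.

data PPath (R : List (ℕ × ℕ)) : ℕ → ℕ → List Dia → Set where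
  stop  : ∀ {x} → PPath R x x []
  fstep : ∀ {x z y Π} → (x , z) ∈ R → PPath R z y Π → PPath R x y (fut ∷ Π)
  pstep : ∀ {x z y Π} → (z , x) ∈ R → PPath R z y Π → PPath R x y (past ∷ Π)

data Proof (P : PathAxioms) : Seq → Set where
  id    : ∀ {S R x p Γ} →
          S ≈S mkSeq R ((x , var p) ∷ (x , nvar p) ∷ Γ) → Proof P S
  ∨r    : ∀ {S R x A B Γ} →
          S ≈S mkSeq R ((x , A ∨ B) ∷ Γ) →
          Proof P (mkSeq R ((x , A) ∷ (x , B) ∷ Γ)) → Proof P S
  ∧r    : ∀ {S R x A B Γ} →
          S ≈S mkSeq R ((x , A ∧ B) ∷ Γ) →
          Proof P (mkSeq R ((x , A) ∷ Γ)) →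
          Proof P (mkSeq R ((x , B) ∷ Γ)) → Proof P S
  □r    : ∀ {S R x y A Γ} →
          S ≈S mkSeq R ((x , □ A) ∷ Γ) → y ∉ labels S →
          Proof P (mkSeq ((x , y) ∷ R) ((y , A) ∷ Γ)) → Proof P S
  ◇r    : ∀ {S R x y A Γ} →
          S ≈S mkSeq ((x , y) ∷ R) ((x , ◇ A) ∷ Γ) →
          Proof P (mkSeq ((x , y) ∷ R) ((y , A) ∷ (x , ◇ A) ∷ Γ)) → Proof P S
  ■r    : ∀ {S R x y A Γ} →
          S ≈S mkSeq R ((x , ■ A) ∷ Γ) → y ∉ labels S →
          Proof P (mkSeq ((y , x) ∷ R) ((y , A) ∷ Γ)) → Proof P S
  ◇⁻r   : ∀ {S R x y A Γ} →
          S ≈S mkSeq ((y , x) ∷ R) ((x , ◇⁻ A) ∷ Γ) →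
          Proof P (mkSeq ((y , x) ∷ R) ((y , A) ∷ (x , ◇⁻ A) ∷ Γ)) → Proof P S
  -- LabPr(P): path taken in the premise's propagation graph (same R)
  labpr : ∀ {S R x y d A Γ Π} →
          S ≈S mkSeq R ((x , ⟨ d ⟩ A) ∷ Γ) →
          PPath R x y Π → Closure P Π d →
          Proof P (mkSeq R ((x , ⟨ d ⟩ A) ∷ (y , A) ∷ Γ)) → Proof P S

Every : ∀ {P S} → (Seq → Set) → Proof P S → Set
Every {S = S} Q (id _)          = Q S
Every {S = S} Q (∨r _ d)        = Q S × Every Q d
Every {S = S} Q (∧r _ d₁ d₂)    = Q S × Every Q d₁ × Every Q d₂
Every {S = S} Q (□r _ _ d)      = Q S × Every Q d
Every {S = S} Q (◇r _ d)        = Q S × Every Q d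
Every {S = S} Q (■r _ _ d)      = Q S × Every Q d
Every {S = S} Q (◇⁻r _ d)       = Q S × Every Q d
Every {S = S} Q (labpr _ _ _ d) = Q S × Every Q d

-- The graph of R,Γ has the labels of the sequent as vertices and an
-- edge (x,y) for each Rxy ∈ R.  Its underlying undirected graph has one
-- undirected edge per directed edge (x,y).

-- Undirected walks: the list of edges traversed and the list of
-- departure vertices.
data UWalk (R : List (ℕ × ℕ)) : ℕ → ℕ → List (ℕ × ℕ) → List ℕ → Set where
  nil : ∀ {x} → UWalk R x x [] []
  fwd : ∀ {x z y es vs} → (x , z) ∈ R → UWalk R z y es vs →
        UWalk R x y ((x , z) ∷ es) (x ∷ vs)
  bwd : ∀ {x z y es vs} → (z , x) ∈ R → UWalk R z y es vs →
        UWalk R x y ((z , x) ∷ es) (x ∷ vs)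

Cycle : List (ℕ × ℕ) → Set
Cycle R = ∃[ x ] ∃[ e ] ∃[ es ] ∃[ vs ]
  (UWalk R x x (e ∷ es) vs × Unique (e ∷ es) × Unique vs)

Connected : Seq → Set
Connected S = ∀ {x y} → x ∈ labels S → y ∈ labels S →
              ∃[ es ] ∃[ vs ] UWalk (rel S) x y es vs

Acyclic : Seq → Set
Acyclic S = ¬ Cycle (rel S)

Polytree : Seq → Set
Polytree S = Connected S × Acyclic S

-- Read bottom-up, every rule either keeps the relational atoms (up to permutation) and writes
-- formulae only at labels already present, or (□ and ■) adds one edge between an existing label x
-- and a fresh label y. The first kind leaves the underlying graph unchanged. The second attaches a
-- leaf to a tree: y is joined to everything through x, and a cycle through the new edge would have
-- to leave y along a second edge, which does not exist.
module Submission where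

open import Defs
open import Function using (_∘_)
open import Data.Nat using (ℕ)
open import Data.Nat.Properties using (_≟_)
open import Data.Product as Product using (_×_; _,_; proj₁; proj₂; ∃-syntax)
open import Data.Product.Properties using (≡-dec)
open import Data.Sum using (_⊎_; inj₁; inj₂; reduce)
open import Data.Empty using (⊥-elim)
open import Data.List using (List; []; _∷_; _++_)
open import Data.List.Membership.Propositional using (_∈_; _∉_)
open import Data.List.Membership.Propositional.Properties using (∈-map⁺; ∈-map⁻)
open import Data.List.Membership.DecPropositional (≡-dec _≟_ _≟_) using (_∈?_)
open import Data.List.Relation.Unary.Any using (here; there)
open import Data.List.Relation.Unary.All as All using (All; _∷_)
import Data.List.Relation.Unary.AllPairs as AllPairs
open import Data.List.Relation.Unary.Unique.Propositional using (Unique)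
open import Data.List.Relation.Unary.Unique.Propositional.Properties using (Unique[x∷xs]⇒x∉xs)
open import Data.List.Relation.Binary.Permutation.Propositional using (_↭_; ↭-sym)
open import Data.List.Relation.Binary.Permutation.Propositional.Properties
  using (∈-resp-↭; All-resp-↭)
open import Relation.Binary.PropositionalEquality using (_≡_; _≢_; refl)
open import Relation.Nullary using (¬_; yes; no)

-- An inductive family rather than a function of the label, so that a witness determines the
-- formula as well; labels alone would leave the formulae of a premise unconstrained.
data LabelledIn (L : List ℕ) : ℕ × Fml → Set where
  labelled : ∀ {z} A → z ∈ L → LabelledIn L (z , A)

label∈ : ∀ {L z A} → LabelledIn L (z , A) → z ∈ L
label∈ (labelled _ z∈) = z∈

LabelledIn-map : ∀ {L L′ p} → (∀ {z} → z ∈ L → z ∈ L′) → LabelledIn L p → LabelledIn L′ p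
LabelledIn-map f (labelled A z∈) = labelled A (f z∈)

EdgesWithin : List (ℕ × ℕ) → List ℕ → Set
EdgesWithin R L = ∀ {a b} → (a , b) ∈ R → a ∈ L × b ∈ L

labels-⊆ : ∀ {R Δ L z} → EdgesWithin R L → All (LabelledIn L) Δ →
           z ∈ labels (mkSeq R Δ) → z ∈ L
labels-⊆ {[]} R⊆ Δ⊆ z∈ with _ , z∈Δ , refl ← ∈-map⁻ proj₁ z∈ = label∈ (All.lookup Δ⊆ z∈Δ)
labels-⊆ {_ ∷ R} R⊆ Δ⊆ (here refl)         = proj₁ (R⊆ (here refl))
labels-⊆ {_ ∷ R} R⊆ Δ⊆ (there (here refl)) = proj₂ (R⊆ (here refl))
labels-⊆ {_ ∷ R} R⊆ Δ⊆ (there (there z∈))  = labels-⊆ (R⊆ ∘ there) Δ⊆ z∈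

edge-labels : ∀ R Δ → EdgesWithin R (labels (mkSeq R Δ))
edge-labels (_ ∷ R) Δ (here refl) = here refl , there (here refl)
edge-labels (_ ∷ R) Δ (there e∈)  = Product.map (there ∘ there) (there ∘ there) (edge-labels R Δ e∈)

fml-labels : ∀ R Δ → All (LabelledIn (labels (mkSeq R Δ))) Δ
fml-labels []      Δ = All.tabulate λ { {z , A} z∈ → labelled A (∈-map⁺ proj₁ z∈) }
fml-labels (_ ∷ R) Δ = All.map (LabelledIn-map (there ∘ there)) (fml-labels R Δ)

edges-within : ∀ {S R} → rel S ↭ R → EdgesWithin R (labels S)
edges-within {S} R↭ = edge-labels (rel S) (fml S) ∘ ∈-resp-↭ (↭-sym R↭)

fml-within : ∀ {S Δ} → fml S ↭ Δ → All (LabelledIn (labels S)) Δ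
fml-within {S} Δ↭ = All-resp-↭ Δ↭ (fml-labels (rel S) (fml S))

PPath-target : ∀ {R L x y Π} → EdgesWithin R L → x ∈ L → PPath R x y Π → y ∈ L
PPath-target R⊆ x∈ stop        = x∈
PPath-target R⊆ x∈ (fstep e∈ π) = PPath-target R⊆ (proj₂ (R⊆ e∈)) π
PPath-target R⊆ x∈ (pstep e∈ π) = PPath-target R⊆ (proj₁ (R⊆ e∈)) π

Walk : List (ℕ × ℕ) → ℕ → ℕ → Set
Walk R a b = ∃[ es ] ∃[ vs ] UWalk R a b es vs

UWalk-map : ∀ {R R′ a b es vs} → (∀ {e} → e ∈ R → e ∈ R′) →
            UWalk R a b es vs → UWalk R′ a b es vs
UWalk-map f nil         = nil
UWalk-map f (fwd e∈ w) = fwd (f e∈) (UWalk-map f w)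
UWalk-map f (bwd e∈ w) = bwd (f e∈) (UWalk-map f w)

UWalk-++ : ∀ {R a b c es vs es′ vs′} → UWalk R a b es vs → UWalk R b c es′ vs′ →
           UWalk R a c (es ++ es′) (vs ++ vs′)
UWalk-++ nil         w′ = w′
UWalk-++ (fwd e∈ w) w′ = fwd e∈ (UWalk-++ w w′)
UWalk-++ (bwd e∈ w) w′ = bwd e∈ (UWalk-++ w w′)

UWalk-avoiding : ∀ {R e a b es vs} → e ∉ es → UWalk (e ∷ R) a b es vs → UWalk R a b es vs
UWalk-avoiding e∉ nil                 = nil
UWalk-avoiding e∉ (fwd (here refl) w) = ⊥-elim (e∉ (here refl))
UWalk-avoiding e∉ (fwd (there e∈) w)  = fwd e∈ (UWalk-avoiding (e∉ ∘ there) w)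
UWalk-avoiding e∉ (bwd (here refl) w) = ⊥-elim (e∉ (here refl))
UWalk-avoiding e∉ (bwd (there e∈) w)  = bwd e∈ (UWalk-avoiding (e∉ ∘ there) w)

Walk-map : ∀ {R R′ a b} → (∀ {e} → e ∈ R → e ∈ R′) → Walk R a b → Walk R′ a b
Walk-map f (es , vs , w) = es , vs , UWalk-map f w

Walk-++ : ∀ {R a b c} → Walk R a b → Walk R b c → Walk R a c
Walk-++ (_ , _ , w) (_ , _ , w′) = _ , _ , UWalk-++ w w′

Cycle-map : ∀ {R R′} → (∀ {e} → e ∈ R → e ∈ R′) → Cycle R → Cycle R′
Cycle-map f (x , e , es , vs , w , uniq-es , uniq-vs) = x , e , es , vs , UWalk-map f w , uniq-es , uniq-vs

connected-via : ∀ {T} h → (∀ {z} → z ∈ labels T → Walk (rel T) z h) →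
                (∀ {z} → z ∈ labels T → Walk (rel T) h z) → Connected T
connected-via h to-h from-h a∈ b∈ = Walk-++ (to-h a∈) (from-h b∈)

polytree-same-edges : ∀ {S R Δ} → Polytree S → rel S ↭ R → All (LabelledIn (labels S)) Δ →
                      Polytree (mkSeq R Δ)
polytree-same-edges {S} {R} {Δ} (conn , acyc) R↭ Δ⊆ =
  (λ a∈ b∈ → Walk-map (∈-resp-↭ R↭) (conn (old a∈) (old b∈))) ,
  acyc ∘ Cycle-map (∈-resp-↭ (↭-sym R↭))
  where
  old : ∀ {z} → z ∈ labels (mkSeq R Δ) → z ∈ labels S
  old = labels-⊆ (edges-within R↭) Δ⊆

Fresh : ℕ → List (ℕ × ℕ) → Set
Fresh y R = ∀ {a b} → (a , b) ∈ R → a ≢ y × b ≢ y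

Fresh-outside : ∀ {R L y} → EdgesWithin R L → y ∉ L → Fresh y R
Fresh-outside R⊆ y∉ e∈ = (λ { refl → y∉ (proj₁ (R⊆ e∈)) }) , (λ { refl → y∉ (proj₂ (R⊆ e∈)) })

module _ {R y} (fresh : Fresh y R) where

  UWalk-from-fresh : ∀ {b es vs} → UWalk R y b es vs → b ≡ y
  UWalk-from-fresh nil         = refl
  UWalk-from-fresh (fwd e∈ _) = ⊥-elim (proj₁ (fresh e∈) refl)
  UWalk-from-fresh (bwd e∈ _) = ⊥-elim (proj₂ (fresh e∈) refl)

  UWalk-to-fresh : ∀ {a es vs} → UWalk R a y es vs → a ≡ y
  UWalk-to-fresh nil = refl
  UWalk-to-fresh (fwd e∈ w) with refl ← UWalk-to-fresh w = ⊥-elim (proj₂ (fresh e∈) refl)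
  UWalk-to-fresh (bwd e∈ w) with refl ← UWalk-to-fresh w = ⊥-elim (proj₁ (fresh e∈) refl)

data Pendant (x y : ℕ) : ℕ × ℕ → Set where
  outward : Pendant x y (x , y)
  inward  : Pendant x y (y , x)

module _ {R x y} (fresh : Fresh y R) (x≢y : x ≢ y) where

  Pendant-∉ : ∀ {e} → Pendant x y e → e ∉ R
  Pendant-∉ outward e∈ = proj₂ (fresh e∈) refl
  Pendant-∉ inward  e∈ = proj₁ (fresh e∈) refl

  -- Once a trail enters the leaf y it cannot leave again, so the pendant edge is its first or last step.
  pendant-trail-end : ∀ {e a b es vs} → Pendant x y e → Unique es → e ∈ es →
                      UWalk (e ∷ R) a b es vs → a ≡ y ⊎ b ≡ y
  pendant-trail-end outward uniq _ (fwd (here refl) w) =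
    inj₂ (UWalk-from-fresh fresh (UWalk-avoiding (Unique[x∷xs]⇒x∉xs uniq) w))
  pendant-trail-end inward uniq _ (fwd (here refl) w) = inj₁ refl
  pendant-trail-end outward uniq _ (bwd (here refl) w) = inj₁ refl
  pendant-trail-end inward uniq _ (bwd (here refl) w) =
    inj₂ (UWalk-from-fresh fresh (UWalk-avoiding (Unique[x∷xs]⇒x∉xs uniq) w))
  pendant-trail-end p uniq (here refl) (fwd (there e∈) w) = ⊥-elim (Pendant-∉ p e∈)
  pendant-trail-end p uniq (here refl) (bwd (there e∈) w) = ⊥-elim (Pendant-∉ p e∈)
  pendant-trail-end p uniq (there e∈es) (fwd (there e∈) w)
    with pendant-trail-end p (AllPairs.tail uniq) e∈es w
  ... | inj₁ refl = ⊥-elim (proj₂ (fresh e∈) refl)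
  ... | inj₂ b≡y  = inj₂ b≡y
  pendant-trail-end p uniq (there e∈es) (bwd (there e∈) w)
    with pendant-trail-end p (AllPairs.tail uniq) e∈es w
  ... | inj₁ refl = ⊥-elim (proj₁ (fresh e∈) refl)
  ... | inj₂ b≡y  = inj₂ b≡y

  no-trail-around-leaf : ∀ {e e₁ es vs} → Pendant x y e → Unique (e₁ ∷ es) →
                         ¬ UWalk (e ∷ R) y y (e₁ ∷ es) vs
  no-trail-around-leaf outward uniq (fwd (here refl) w) = x≢y refl
  no-trail-around-leaf inward uniq (fwd (here refl) w) =
    x≢y (UWalk-to-fresh fresh (UWalk-avoiding (Unique[x∷xs]⇒x∉xs uniq) w))
  no-trail-around-leaf outward uniq (bwd (here refl) w) =
    x≢y (UWalk-to-fresh fresh (UWalk-avoiding (Unique[x∷xs]⇒x∉xs uniq) w))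
  no-trail-around-leaf inward uniq (bwd (here refl) w) = x≢y refl
  no-trail-around-leaf p uniq (fwd (there e∈) w) = proj₁ (fresh e∈) refl
  no-trail-around-leaf p uniq (bwd (there e∈) w) = proj₂ (fresh e∈) refl

  acyclic-pendant : ∀ {e} → Pendant x y e → ¬ Cycle R → ¬ Cycle (e ∷ R)
  acyclic-pendant {e} p acyc (z , e₁ , es , vs , w , uniq-es , uniq-vs) with e ∈? (e₁ ∷ es)
  ... | no e∉ = acyc (z , e₁ , es , vs , UWalk-avoiding e∉ w , uniq-es , uniq-vs)
  ... | yes e∈ with refl ← reduce (pendant-trail-end p uniq-es e∈ w) =
    no-trail-around-leaf p uniq-es w

Pendant-walk-to : ∀ {R x y e} → Pendant x y e → Walk (e ∷ R) y x
Pendant-walk-to outward = _ , _ , bwd (here refl) nil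
Pendant-walk-to inward  = _ , _ , fwd (here refl) nil

Pendant-walk-from : ∀ {R x y e} → Pendant x y e → Walk (e ∷ R) x y
Pendant-walk-from outward = _ , _ , fwd (here refl) nil
Pendant-walk-from inward  = _ , _ , bwd (here refl) nil

polytree-pendant : ∀ {S R Δ x y e} → Polytree S → rel S ↭ R → x ∈ labels S → y ∉ labels S →
                   Pendant x y e → All (LabelledIn (y ∷ labels S)) Δ → Polytree (mkSeq (e ∷ R) Δ)
polytree-pendant {S} {R} {Δ} {x} {y} {e} (conn , acyc) R↭ x∈ y∉ p Δ⊆ =
  connected-via x (to-x ∘ old) (from-x ∘ old) ,
  acyclic-pendant (Fresh-outside R⊆ y∉) x≢y p (acyc ∘ Cycle-map (∈-resp-↭ (↭-sym R↭)))
  where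
  R⊆ : EdgesWithin R (labels S)
  R⊆ = edges-within R↭

  x≢y : x ≢ y
  x≢y refl = y∉ x∈

  endpoints : ∀ {a b} → Pendant x y (a , b) → a ∈ y ∷ labels S × b ∈ y ∷ labels S
  endpoints outward = there x∈ , here refl
  endpoints inward  = here refl , there x∈

  eR⊆ : EdgesWithin (e ∷ R) (y ∷ labels S)
  eR⊆ (here refl) = endpoints p
  eR⊆ (there e∈)  = Product.map there there (R⊆ e∈)

  old : ∀ {z} → z ∈ labels (mkSeq (e ∷ R) Δ) → z ∈ y ∷ labels S
  old = labels-⊆ eR⊆ Δ⊆

  lift : ∀ {a b} → Walk (rel S) a b → Walk (e ∷ R) a b
  lift = Walk-map (there ∘ ∈-resp-↭ R↭)

  to-x : ∀ {z} → z ∈ y ∷ labels S → Walk (e ∷ R) z x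
  to-x (here refl) = Pendant-walk-to p
  to-x (there z∈)  = lift (conn z∈ x∈)

  from-x : ∀ {z} → z ∈ y ∷ labels S → Walk (e ∷ R) x z
  from-x (here refl) = Pendant-walk-from p
  from-x (there z∈)  = lift (conn x∈ z∈)

lemma5p11 : (P : PathAxioms) (S : Seq) (d : Proof P S) →
    Polytree S → Every Polytree d
lemma5p11 P S (id _) pt = pt
lemma5p11 P S (∨r {A = A} {B = B} (R↭ , Δ↭) d) pt
  with labelled _ x∈ ∷ Γ⊆ ← fml-within {S} Δ↭ =
  pt , lemma5p11 P _ d (polytree-same-edges {S} pt R↭ (labelled A x∈ ∷ labelled B x∈ ∷ Γ⊆))
lemma5p11 P S (∧r {A = A} {B = B} (R↭ , Δ↭) d₁ d₂) pt
  with labelled _ x∈ ∷ Γ⊆ ← fml-within {S} Δ↭ =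
  pt , lemma5p11 P _ d₁ (polytree-same-edges {S} pt R↭ (labelled A x∈ ∷ Γ⊆))
     , lemma5p11 P _ d₂ (polytree-same-edges {S} pt R↭ (labelled B x∈ ∷ Γ⊆))
lemma5p11 P S (□r {A = A} (R↭ , Δ↭) y∉ d) pt
  with labelled _ x∈ ∷ Γ⊆ ← fml-within {S} Δ↭ =
  pt , lemma5p11 P _ d (polytree-pendant {S} pt R↭ x∈ y∉ outward
                          (labelled A (here refl) ∷ All.map (LabelledIn-map there) Γ⊆))
lemma5p11 P S (■r {A = A} (R↭ , Δ↭) y∉ d) pt
  with labelled _ x∈ ∷ Γ⊆ ← fml-within {S} Δ↭ =
  pt , lemma5p11 P _ d (polytree-pendant {S} pt R↭ x∈ y∉ inward
                          (labelled A (here refl) ∷ All.map (LabelledIn-map there) Γ⊆))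
lemma5p11 P S (◇r {A = A} (R↭ , Δ↭) d) pt with ◇A∈ ∷ Γ⊆ ← fml-within {S} Δ↭ =
  pt , lemma5p11 P _ d (polytree-same-edges {S} pt R↭
                          (labelled A (proj₂ (edges-within {S} R↭ (here refl))) ∷ ◇A∈ ∷ Γ⊆))
lemma5p11 P S (◇⁻r {A = A} (R↭ , Δ↭) d) pt with ◇⁻A∈ ∷ Γ⊆ ← fml-within {S} Δ↭ =
  pt , lemma5p11 P _ d (polytree-same-edges {S} pt R↭
                          (labelled A (proj₁ (edges-within {S} R↭ (here refl))) ∷ ◇⁻A∈ ∷ Γ⊆))
lemma5p11 P S (labpr {A = A} (R↭ , Δ↭) π _ d) pt with ⟨d⟩A∈ ∷ Γ⊆ ← fml-within {S} Δ↭ =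
  pt , lemma5p11 P _ d (polytree-same-edges {S} pt R↭
                          (⟨d⟩A∈ ∷ labelled A (PPath-target (edges-within {S} R↭) (label∈ ⟨d⟩A∈) π) ∷ Γ⊆))
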